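{- Let $\mathcal{L}=(\Sigma,R)$ be a finitely nested $\lambda$-TRS. Then for all $k\in\mathbb{N}$, all $(k+1)$-ary contexts $C$ over $\Sigma$, and all terms $s_1,\dots,s_k,t$ over $\Sigma$: $$|C(s_1,\dots,s_k,t)|_\lambda \le \max\{\,|C(s_1,\dots,s_k,x)|_\lambda,\ |C(x_1,\dots,x_{k+1})|_\lambda + |t|_\lambda\,\},$$ where $x,x_1,\dots,x_{k+1}$ are term variables.
   Context: A $\lambda$-TRS is a pair $\mathcal{L}=(\Sigma,R)$ where $\Sigma$ is a signature containing the binary application symbol $@$; the symbols in $\Sigma^-:=\Sigma\setminus\{@\}$ are called scope symbols, and $R$ contains, for each scope symbol $f$ of arity $k$, exactly one (defining) rule $@(f(x_1,\dots,x_k),y)\to F(x_1,\dots,x_k,y)$, where $F$ is a $(k+1)$-ary context over $\Sigma$, the scope context of $f$. A scope symbol $f$ depends on $g$ if $g$ occurs in the scope context of $f$; $\mathcal{L}$ is finitely nested if there is no infinite chain $f_0,f_1,f_2,\dots$ of scope symbols with each $f_m$ depending on $f_{m+1}$. Let $\Sigma_\lambda$ consist of constants $v_j$ ($j\in\mathbb{N}$), $@$, and unary named-abstraction symbols $\lambda v_j$ ($j\in\mathbb{N}$), disjoint from $\Sigma^-$. Expansion: add unary symbols $\mathit{exp}_i$ ($i\in\mathbb{N}$) with rules $\mathit{exp}_i(@(x_1,x_2))\to @(\mathit{exp}_i(x_1),\mathit{exp}_i(x_2))$; $\mathit{exp}_i(f(x_1,\dots,x_k))\to\lambda v_i(\mathit{exp}_{i+1}(F(x_1,\dots,x_k,v_i)))$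 for each scope symbol $f$ with scope context $F$; $\mathit{exp}_i(v_j)\to v_j$; $\mathit{exp}_i(\lambda v_j(x))\to\lambda v_j(\mathit{exp}_{\max\{i,j\}+1}(x))$. For a term $t$, $[\![t]\!]$ is the unique (finite or infinite) normal form of $\mathit{exp}_0(t)$, and the $\lambda$-term depth $|t|_\lambda\in\mathbb{N}\cup\{\infty\}$ is the depth (longest root-to-leaf path length) of $[\![t]\!]$, where term variables (and residual $\mathit{exp}_i(x)$ for a variable $x$) have depth $0$. -}

module Defs where

open import Data.Nat using (ℕ; zero; suc; _+_; _⊔_; _≤_)
open import Data.Fin using (Fin; zero; suc)
open import Data.Product using (Σ; ∃; _×_; _,_)
open import Data.Sum using (_⊎_)
open import Data.Unit using (⊤)
open import Data.Empty using (⊥)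
open import Relation.Nullary using (¬_)
open import Relation.Binary.PropositionalEquality using (_≡_)

-- Terms over Σ ∪ Σ_λ with variables from V.
-- The scope symbols Σ⁻ form a type S with arities ar; @ is `app`;
-- `vr j` is the constant v_j and `lam j` is the named abstraction λv_j.

data Tm {S : Set} (ar : S → ℕ) (V : Set) : Set where
  var : V → Tm ar V
  app : Tm ar V → Tm ar V → Tm ar V
  fn  : (f : S) → (Fin (ar f) → Tm ar V) → Tm ar V
  vr  : ℕ → Tm ar V
  lam : ℕ → Tm ar V → Tm ar V

ext : {A : Set} {k : ℕ} → (Fin k → A) → A → Fin (suc k) → A
ext {k = zero}  s a zero    = a
ext {k = suc k} s a zero    = s zero
ext {k = suc k} s a (suc i) = ext (λ j → s (suc j)) a i

module _ {S : Set} {ar : S → ℕ} where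

  Pure : {V : Set} → Tm ar V → Set
  Pure (var x)   = ⊤
  Pure (app a b) = Pure a × Pure b
  Pure (fn f as) = ∀ i → Pure (as i)
  Pure (vr j)    = ⊥
  Pure (lam j a) = ⊥

  Occurs : {V : Set} → S → Tm ar V → Set
  Occurs g (var x)   = ⊥
  Occurs g (app a b) = Occurs g a ⊎ Occurs g b
  Occurs g (fn f as) = g ≡ f ⊎ Σ (Fin (ar f)) (λ i → Occurs g (as i))
  Occurs g (vr j)    = ⊥
  Occurs g (lam j a) = Occurs g a

  _[_] : {V W : Set} → Tm ar V → (V → Tm ar W) → Tm ar W
  var x   [ σ ] = σ x
  app a b [ σ ] = app (a [ σ ]) (b [ σ ])
  fn f as [ σ ] = fn f (λ i → as i [ σ ])
  vr j    [ σ ] = vr j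
  lam j a [ σ ] = lam j (a [ σ ])

-- A λ-TRS: for each scope symbol f of arity k exactly one defining rule
-- @(f(x₁,…,x_k),y) → F(x₁,…,x_k,y), so it is determined by the scope
-- contexts F, which are (k+1)-ary contexts over Σ.

record LTRS : Set₁ where
  field
    S      : Set
    ar     : S → ℕ
    scope  : (f : S) → Tm ar (Fin (suc (ar f)))
    scope-pure : (f : S) → Pure (scope f)

open LTRS public

DependsOn : (L : LTRS) → S L → S L → Set
DependsOn L f g = Occurs g (scope L f)

FinitelyNested : LTRS → Set
FinitelyNested L =
  ¬ (Σ (ℕ → S L) λ c → ∀ m → DependsOn L (c m) (c (suc m)))

-- λ-terms produced by expansion (with term variables from V).
-- `cut` marks a position not yet computed (out of fuel).

data LTm (V : Set) : Set where
  var : V → LTm V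
  vv  : ℕ → LTm V
  app : LTm V → LTm V → LTm V
  lam : ℕ → LTm V → LTm V
  cut : LTm V

depth : {V : Set} → LTm V → ℕ
depth (var x)   = 0
depth (vv j)    = 0
depth (app a b) = suc (depth a ⊔ depth b)
depth (lam j a) = suc (depth a)
depth cut       = 0

-- expand L n i t : the normal form of exp_i(t), truncated at height n
-- (each output node costs one unit of fuel; residual exp_i(x) for a
-- variable x is kept as the variable, of depth 0).
expand : (L : LTRS) {V : Set} → ℕ → ℕ → Tm (ar L) V → LTm V
expand L zero    i t         = cut
expand L (suc n) i (var x)   = var x
expand L (suc n) i (app a b) = app (expand L n i a) (expand L n i b)
expand L (suc n) i (fn f as) =
  lam i (expand L n (suc i) (scope L f [ ext as (vr i) ]))
expand L (suc n) i (vr j)    = vv j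
expand L (suc n) i (lam j a) = lam j (expand L n (suc (i ⊔ j)) a)

-- ℕ ∪ {∞}, represented by increasing sequences (value = supremum).

ℕ∞ : Set
ℕ∞ = ℕ → ℕ

_≤∞_ : ℕ∞ → ℕ∞ → Set
a ≤∞ b = ∀ n → ∃ λ m → a n ≤ b m

_⊔∞_ : ℕ∞ → ℕ∞ → ℕ∞
(a ⊔∞ b) n = a n ⊔ b n

_+∞_ : ℕ∞ → ℕ∞ → ℕ∞
(a +∞ b) n = a n + b n

-- |t|_λ : depth of ⟦t⟧ = normal form of exp₀(t)
-- (= supremum over n of the depth of its height-n truncation)
λdepth : (L : LTRS) {V : Set} → Tm (ar L) V → ℕ∞
λdepth L t n = depth (expand L n 0 t)

-- Expanding C(s⃗, t) proceeds exactly like expanding C(s⃗, x), except below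
-- the occurrences of t; each of these sits at a variable leaf of C(x⃗), where
-- the expansion of t adds at most |t|_λ to the depth. For this comparison the
-- names of the bound variables v_i are irrelevant: the depth of an expansion
-- does not depend on them. The inequality is proved for each height-n
-- truncation by induction on n, for all triples of terms related like
-- C(s⃗, t), C(s⃗, x) and C(x⃗); the relation is stable under instantiating scope
-- contexts, which is what the expansion of a scope symbol does.
module Submission where

open import Defs
open import Data.Nat using (ℕ; zero; suc; _+_; _⊔_; _≤_; z≤n; s≤s)
open import Data.Nat.Properties
  using (≤-reflexive; ≤-trans; ⊔-lub; ⊔-mono-≤; ⊔-monoʳ-≤; m≤m⊔n; m≤n⊔m; +-monoˡ-≤; +-monoʳ-≤)
open import Data.Fin using (Fin; zero; suc)
open import Data.Product using (_,_)
open import Relation.Binary.PropositionalEquality using (_≡_; refl; cong; cong₂)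

ext-pointwise : {A B : Set} (R : A → B → Set) {k : ℕ} {as : Fin k → A} {bs : Fin k → B} {a : A} {b : B} →
                (∀ l → R (as l) (bs l)) → R a b → ∀ w → R (ext as a w) (ext bs b w)
ext-pointwise R {k = zero}  _  r zero    = r
ext-pointwise R {k = suc k} rs r zero    = rs zero
ext-pointwise R {k = suc k} rs r (suc w) = ext-pointwise R (λ l → rs (suc l)) r w

ext-pointwise₃ : {A : Set} (R : A → A → A → Set) {k : ℕ} {as bs cs : Fin k → A} {a b c : A} →
                 (∀ l → R (as l) (bs l) (cs l)) → R a b c → ∀ w → R (ext as a w) (ext bs b w) (ext cs c w)
ext-pointwise₃ R {k = zero}  _  r zero    = r
ext-pointwise₃ R {k = suc k} rs r zero    = rs zero
ext-pointwise₃ R {k = suc k} rs r (suc w) = ext-pointwise₃ R (λ l → rs (suc l)) r w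

max-plus-lub : ∀ {x₁ x₂} y₁ y₂ z₁ z₂ d →
               x₁ ≤ y₁ ⊔ (z₁ + d) → x₂ ≤ y₂ ⊔ (z₂ + d) → x₁ ⊔ x₂ ≤ (y₁ ⊔ y₂) ⊔ ((z₁ ⊔ z₂) + d)
max-plus-lub y₁ y₂ z₁ z₂ d p q =
  ⊔-lub (≤-trans p (⊔-mono-≤ (m≤m⊔n y₁ y₂) (+-monoˡ-≤ d (m≤m⊔n z₁ z₂))))
        (≤-trans q (⊔-mono-≤ (m≤n⊔m y₁ y₂) (+-monoˡ-≤ d (m≤n⊔m z₁ z₂))))

module _ (L : LTRS) where

  private
    T : Set → Set
    T = Tm (ar L)

  exp-depth : {V : Set} → ℕ → ℕ → T V → ℕ
  exp-depth n i a = depth (expand L n i a)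

  exp-depth-≤-suc : {V : Set} (n i : ℕ) (a : T V) → exp-depth n i a ≤ exp-depth (suc n) i a
  exp-depth-≤-suc zero    i a         = z≤n
  exp-depth-≤-suc (suc n) i (var x)   = z≤n
  exp-depth-≤-suc (suc n) i (app a b) = s≤s (⊔-mono-≤ (exp-depth-≤-suc n i a) (exp-depth-≤-suc n i b))
  exp-depth-≤-suc (suc n) i (fn f as) = s≤s (exp-depth-≤-suc n (suc i) _)
  exp-depth-≤-suc (suc n) i (vr j)    = z≤n
  exp-depth-≤-suc (suc n) i (lam j a) = s≤s (exp-depth-≤-suc n _ a)

  infix 4 _∼_

  data _∼_ {V : Set} : T V → T V → Set where
    var : ∀ x → var x ∼ var x
    app : ∀ {a b c d} → a ∼ c → b ∼ d → app a b ∼ app c d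
    fn  : ∀ f {as bs} → (∀ i → as i ∼ bs i) → fn f as ∼ fn f bs
    vr  : ∀ i j → vr i ∼ vr j
    lam : ∀ i j {a b} → a ∼ b → lam i a ∼ lam j b

  ∼-refl : {V : Set} (a : T V) → a ∼ a
  ∼-refl (var x)   = var x
  ∼-refl (app a b) = app (∼-refl a) (∼-refl b)
  ∼-refl (fn f as) = fn f (λ i → ∼-refl (as i))
  ∼-refl (vr j)    = vr j j
  ∼-refl (lam j a) = lam j j (∼-refl a)

  ∼-subst : {V W : Set} (u : T W) {σ τ : W → T V} → (∀ w → σ w ∼ τ w) → u [ σ ] ∼ u [ τ ]
  ∼-subst (var x)   p = p x
  ∼-subst (app a b) p = app (∼-subst a p) (∼-subst b p)
  ∼-subst (fn f as) p = fn f (λ i → ∼-subst (as i) p)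
  ∼-subst (vr j)    p = vr j j
  ∼-subst (lam j a) p = lam j j (∼-subst a p)

  ∼⇒exp-depth-≡ : {V : Set} (n i j : ℕ) {a b : T V} → a ∼ b → exp-depth n i a ≡ exp-depth n j b
  ∼⇒exp-depth-≡ zero    i j _           = refl
  ∼⇒exp-depth-≡ (suc n) i j (var x)     = refl
  ∼⇒exp-depth-≡ (suc n) i j (app p q)   = cong suc (cong₂ _⊔_ (∼⇒exp-depth-≡ n i j p) (∼⇒exp-depth-≡ n i j q))
  ∼⇒exp-depth-≡ (suc n) i j (fn f p)    =
    cong suc (∼⇒exp-depth-≡ n (suc i) (suc j) (∼-subst (scope L f) (ext-pointwise _∼_ p (vr i j))))
  ∼⇒exp-depth-≡ (suc n) i j (vr _ _)    = refl
  ∼⇒exp-depth-≡ (suc n) i j (lam _ _ p) = cong suc (∼⇒exp-depth-≡ n _ _ p)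

  module _ {V : Set} (t : T V) where

    -- Graft a b c: b with t grafted in place of some of its variable leaves
    -- is a, and c is the common context of a and b with every grafting
    -- position, and possibly further subterms, replaced by variables.
    data Graft : T V → T V → T V → Set where
      graft : ∀ x y → Graft t (var x) (var y)
      keep  : ∀ a y → Graft a a (var y)
      app   : ∀ {a₁ b₁ c₁ a₂ b₂ c₂} → Graft a₁ b₁ c₁ → Graft a₂ b₂ c₂ →
              Graft (app a₁ a₂) (app b₁ b₂) (app c₁ c₂)
      fn    : ∀ f {as bs cs} → (∀ i → Graft (as i) (bs i) (cs i)) → Graft (fn f as) (fn f bs) (fn f cs)
      vr    : ∀ j → Graft (vr j) (vr j) (vr j)
      lam   : ∀ j {a b c} → Graft a b c → Graft (lam j a) (lam j b) (lam j c)

    Graft-subst : {W : Set} (u : T W) {σ τ υ : W → T V} → (∀ w → Graft (σ w) (τ w) (υ w)) →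
                  Graft (u [ σ ]) (u [ τ ]) (u [ υ ])
    Graft-subst (var x)   p = p x
    Graft-subst (app a b) p = app (Graft-subst a p) (Graft-subst b p)
    Graft-subst (fn f as) p = fn f (λ i → Graft-subst (as i) p)
    Graft-subst (vr j)    p = vr j
    Graft-subst (lam j a) p = lam j (Graft-subst a p)

    Graft-holes : {k : ℕ} (s : Fin k → T V) (x : V) (xs : Fin (suc k) → V) →
                  ∀ w → Graft (ext s t w) (ext s (var x) w) (var (xs w))
    Graft-holes {zero}  s x xs zero    = graft x (xs zero)
    Graft-holes {suc k} s x xs zero    = keep (s zero) (xs zero)
    Graft-holes {suc k} s x xs (suc w) = Graft-holes (λ l → s (suc l)) x (λ l → xs (suc l)) w

    Graft⇒exp-depth-≤ : (n i : ℕ) {a b c : T V} → Graft a b c →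
                        exp-depth n i a ≤ exp-depth n i b ⊔ (exp-depth n i c + exp-depth n 0 t)
    Graft⇒exp-depth-≤ zero    i _ = z≤n
    Graft⇒exp-depth-≤ (suc n) i r = step i r
      where
      IH : ∀ i {a b c} → Graft a b c →
           exp-depth n i a ≤ exp-depth n i b ⊔ (exp-depth n i c + exp-depth (suc n) 0 t)
      IH i r = ≤-trans (Graft⇒exp-depth-≤ n i r)
                       (⊔-monoʳ-≤ (exp-depth n i _) (+-monoʳ-≤ (exp-depth n i _) (exp-depth-≤-suc n 0 t)))

      step : ∀ i {a b c} → Graft a b c →
             exp-depth (suc n) i a ≤ exp-depth (suc n) i b ⊔ (exp-depth (suc n) i c + exp-depth (suc n) 0 t)
      step i (graft x y) = ≤-reflexive (∼⇒exp-depth-≡ (suc n) i 0 (∼-refl t))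
      step i (keep a y)  = m≤m⊔n _ _
      step i (app {b₁ = b₁} {c₁} {b₂ = b₂} {c₂} p q) =
        s≤s (max-plus-lub (exp-depth n i b₁) (exp-depth n i b₂) (exp-depth n i c₁) (exp-depth n i c₂) _
                          (IH i p) (IH i q))
      step i (fn f p)    = s≤s (IH (suc i) (Graft-subst (scope L f) (ext-pointwise₃ Graft p (vr i))))
      step i (vr j)      = z≤n
      step i (lam j p)   = s≤s (IH _ p)

lemma3p7 : (L : LTRS) → FinitelyNested L →
    (k : ℕ) (C : Tm (ar L) (Fin (suc k))) → Pure C →
    (s : Fin k → Tm (ar L) ℕ) → (∀ i → Pure (s i)) →
    (t : Tm (ar L) ℕ) → Pure t →
    (x : ℕ) (xs : Fin (suc k) → ℕ) →
    λdepth L (C [ ext s t ])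
    ≤∞ (λdepth L (C [ ext s (var x) ])
    ⊔∞ (λdepth L (C [ (λ i → var (xs i)) ]) +∞ λdepth L t))
lemma3p7 L _ k C _ s _ t _ x xs n =
  n , Graft⇒exp-depth-≤ L t n 0 (Graft-subst L t C (Graft-holes L t s x xs))
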